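{- Let $k\ge 2$ be an integer, $n=2^k$ and $m=3\cdot 2^{k-2}$, and let $p$ be a positive integer. Every shuffle-preserved $m$-local coloring of the $n\times n$ complete bipartite graph $K_{n,n}$ contains a monochromatic copy of $K_{p,p}$ if and only if $2(p-1)(m-1)<n$.
   Context: $K_{n,n}$ has bipartition $U\cup V$, $|U|=|V|=n$. A coloring assigns a color to each edge. For a vertex $u$, $C(u)$ is the set of colors on edges incident to $u$; a coloring is $m$-local if $|C(u)|\le m$ for every vertex $u$ (the total number of colors may exceed $m$). Write $(u,v)_c$ if the edge $uv$ has color $c$. A coloring is shuffle-preserved if for all $u,u'\in U$, $v,v'\in V$ and every color $c$, $(u,v)_c$ and $(u',v')_c$ imply $(u,v')_c$ and $(u',v)_c$. A monochromatic copy of $K_{p,p}$ consists of $A\subseteq U$, $B\subseteq V$ with $|A|=|B|=p$ and a color $c$ with $(a,b)_c$ for all $a\in A$, $b\in B$. -}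

module Defs where

open import Data.Nat using (ℕ; _≤_; _≟_)
open import Data.Fin using (Fin)
open import Data.Fin.Subset using (Subset; _∈_; ∣_∣)
open import Data.List using (List; map; length; deduplicate; allFin)
open import Data.Product using (Σ; ∃; _×_)
open import Relation.Binary.PropositionalEquality using (_≡_)

-- A coloring of K_{n,n}: U = V = Fin n, colors are natural numbers
-- (any set of colors of a finite graph can be relabelled by naturals).
-- χ u v is the color of the edge uv (u ∈ U, v ∈ V).
Coloring : ℕ → Set
Coloring n = Fin n → Fin n → ℕ

colorsU : ∀ {n} → Coloring n → Fin n → List ℕ
colorsU {n} χ u = deduplicate _≟_ (map (λ v → χ u v) (allFin n))

colorsV : ∀ {n} → Coloring n → Fin n → List ℕ
colorsV {n} χ v = deduplicate _≟_ (map (λ u → χ u v) (allFin n))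

Local : ∀ {n} → ℕ → Coloring n → Set
Local m χ = (∀ u → length (colorsU χ u) ≤ m) × (∀ v → length (colorsV χ v) ≤ m)

ShufflePreserved : ∀ {n} → Coloring n → Set
ShufflePreserved {n} χ = ∀ (u u' v v' : Fin n) (c : ℕ) →
  χ u v ≡ c → χ u' v' ≡ c → (χ u v' ≡ c) × (χ u' v ≡ c)

HasMonoKpp : ∀ {n} → ℕ → Coloring n → Set
HasMonoKpp {n} p χ =
  Σ (Subset n) λ A → Σ (Subset n) λ B → Σ ℕ λ c →
    (∣ A ∣ ≡ p) × (∣ B ∣ ≡ p) × (∀ a b → a ∈ A → b ∈ B → χ a b ≡ c)

-- With n = 4t and m = 3t, both sides hold for p = 1 and both fail for p ≥ 2.
-- For p ≥ 2 the inequality fails since 2 (3t − 1) ≥ 4t, and a counterexample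
-- splits the vertices into a low and a high half: an edge inside one half gets
-- the color of its V-endpoint, an edge across the halves the color of its
-- U-endpoint.  Every vertex then sees 2t + 1 ≤ m colors, and every color class
-- is a star, which makes the coloring shuffle-preserved and free of
-- monochromatic K₂,₂.
module Submission where

open import Defs
open import Data.Nat using (ℕ; zero; suc; _+_; _*_; _∸_; _^_; _≤_; _<_; z≤n; s≤s; _<?_; _≟_)
open import Function.Bundles using (_⇔_; mk⇔)
open import Data.Nat.Properties
open import Data.Bool using (Bool; true; false; not; _xor_; if_then_else_)
open import Data.Fin as Fin using (Fin; toℕ; fromℕ<)
open import Data.Fin.Properties using (toℕ-injective; toℕ<n)
open import Data.Fin.Subset using (Subset; _∈_; ∣_∣; ⁅_⁆; inside; outside)
open import Data.Fin.Subset.Properties using (∣⁅x⁆∣≡1; x∈⁅y⁆⇒x≡y)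
open import Data.Vec using (_∷_; here; there)
open import Data.List using (List; map; length; upTo) renaming (_∷_ to _∷ₗ_; [] to []ₗ)
open import Data.List.Properties using (length-map; length-upTo; length-removeAt′)
open import Data.List.Membership.Propositional as List using (_─_)
open import Data.List.Membership.Propositional.Properties
  using (∈-map⁺; ∈-map⁻; ∈-upTo⁺; ∈-deduplicate⁻)
open import Data.List.Relation.Unary.Any as Any using ()
import Data.List.Relation.Unary.All as All
open import Data.List.Relation.Unary.AllPairs using (_∷_)
open import Data.List.Relation.Unary.Unique.Propositional using (Unique)
open import Data.List.Relation.Unary.Unique.DecPropositional.Properties _≟_
  using (deduplicate-!)
open import Data.Product using (Σ; ∃₂; _×_; _,_)
open import Data.Sum using (_⊎_; inj₁; inj₂)
open import Data.Empty using (⊥-elim)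
open import Relation.Nullary using (¬_; yes; no)
open import Relation.Nullary.Decidable using (⌊_⌋)
open import Relation.Binary.PropositionalEquality

∈-─ : ∀ {x y : ℕ} {ys} (y∈ys : y List.∈ ys) → x List.∈ ys → x ≢ y →
      x List.∈ ys ─ y∈ys
∈-─ (Any.here refl)  (Any.here refl)  x≢y = ⊥-elim (x≢y refl)
∈-─ (Any.here refl)  (Any.there x∈ys) _   = x∈ys
∈-─ (Any.there y∈ys) (Any.here refl)  _   = Any.here refl
∈-─ (Any.there y∈ys) (Any.there x∈ys) x≢y = Any.there (∈-─ y∈ys x∈ys x≢y)

unique-⊆⇒length-≤ : ∀ {xs ys : List ℕ} → Unique xs →
                    (∀ {z} → z List.∈ xs → z List.∈ ys) → length xs ≤ length ys
unique-⊆⇒length-≤ {[]ₗ} _ _ = z≤n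
unique-⊆⇒length-≤ {x ∷ₗ xs} {ys} (x∉xs ∷ xs!) xs⊆ys = begin
  suc (length xs)           ≤⟨ s≤s (unique-⊆⇒length-≤ xs! xs⊆ys─x) ⟩
  suc (length (ys ─ x∈ys))  ≡⟨ length-removeAt′ ys (Any.index x∈ys) ⟨
  length ys                 ∎
  where
  open ≤-Reasoning
  x∈ys : x List.∈ ys
  x∈ys = xs⊆ys (Any.here refl)
  xs⊆ys─x : ∀ {z} → z List.∈ xs → z List.∈ ys ─ x∈ys
  xs⊆ys─x z∈xs =
    ∈-─ x∈ys (xs⊆ys (Any.there z∈xs)) λ z≡x → All.lookup x∉xs z∈xs (sym z≡x)

colorsU-length-≤ : ∀ {n} (χ : Coloring n) u {ys : List ℕ} →
                   (∀ v → χ u v List.∈ ys) → length (colorsU χ u) ≤ length ys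
colorsU-length-≤ χ u {ys} cover = unique-⊆⇒length-≤ (deduplicate-! _) covered
  where
  covered : ∀ {z} → z List.∈ colorsU χ u → z List.∈ ys
  covered z∈ with ∈-map⁻ _ (∈-deduplicate⁻ _≟_ _ z∈)
  ... | v , _ , refl = cover v

colorsV-length-≤ : ∀ {n} (χ : Coloring n) v {ys : List ℕ} →
                   (∀ u → χ u v List.∈ ys) → length (colorsV χ v) ≤ length ys
colorsV-length-≤ χ v {ys} cover = unique-⊆⇒length-≤ (deduplicate-! _) covered
  where
  covered : ∀ {z} → z List.∈ colorsV χ v → z List.∈ ys
  covered z∈ with ∈-map⁻ _ (∈-deduplicate⁻ _≟_ _ z∈)
  ... | u , _ , refl = cover u

StarColoring : ∀ {n} → Coloring n → Set
StarColoring {n} χ = ∀ (u u' v v' : Fin n) → χ u v ≡ χ u' v' → u ≡ u' ⊎ v ≡ v'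

star⇒shufflePreserved : ∀ {n} {χ : Coloring n} → StarColoring χ → ShufflePreserved χ
star⇒shufflePreserved star u u' v v' c χuv≡c χu'v'≡c
  with star u u' v v' (trans χuv≡c (sym χu'v'≡c))
... | inj₁ refl = χu'v'≡c , χuv≡c
... | inj₂ refl = χuv≡c , χu'v'≡c

TwoElements : ∀ {n} → Subset n → Set
TwoElements {n} A = ∃₂ λ (a a' : Fin n) → a ∈ A × a' ∈ A × a ≢ a'

∣p∣≥1⇒nonempty : ∀ {n} (A : Subset n) → 1 ≤ ∣ A ∣ → Σ (Fin n) (_∈ A)
∣p∣≥1⇒nonempty (inside  ∷ A) _     = Fin.zero , here
∣p∣≥1⇒nonempty (outside ∷ A) 1≤∣A∣ with ∣p∣≥1⇒nonempty A 1≤∣A∣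
... | a , a∈A = Fin.suc a , there a∈A

∣p∣≥2⇒twoElements : ∀ {n} (A : Subset n) → 2 ≤ ∣ A ∣ → TwoElements A
∣p∣≥2⇒twoElements (inside ∷ A) (s≤s 1≤∣A∣) with ∣p∣≥1⇒nonempty A 1≤∣A∣
... | a , a∈A = Fin.zero , Fin.suc a , here , there a∈A , λ ()
∣p∣≥2⇒twoElements (outside ∷ A) 2≤∣A∣ with ∣p∣≥2⇒twoElements A 2≤∣A∣
... | a , a' , a∈A , a'∈A , a≢a' =
  Fin.suc a , Fin.suc a' , there a∈A , there a'∈A , λ { refl → a≢a' refl }

star⇒¬monoKpp : ∀ {n} {χ : Coloring n} → StarColoring χ → ∀ q → ¬ HasMonoKpp (2 + q) χ
star⇒¬monoKpp star q (A , B , c , ∣A∣≡p , ∣B∣≡p , mono)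
  with ∣p∣≥2⇒twoElements A (subst (2 ≤_) (sym ∣A∣≡p) (m≤m+n 2 q))
     | ∣p∣≥2⇒twoElements B (subst (2 ≤_) (sym ∣B∣≡p) (m≤m+n 2 q))
... | a , a' , a∈A , a'∈A , a≢a' | b , b' , b∈B , b'∈B , b≢b'
  with star a a' b b' (trans (mono a b a∈A b∈B) (sym (mono a' b' a'∈A b'∈B)))
... | inj₁ a≡a' = a≢a' a≡a'
... | inj₂ b≡b' = b≢b' b≡b'

-- Colors of U-vertices are even and those of V-vertices odd, so they never clash.
rowColor columnColor : ℕ → ℕ
rowColor a    = 2 * a
columnColor b = suc (2 * b)

RowColumnColoring : ∀ {n} → Coloring n → Set
RowColumnColoring {n} χ =
  ∀ (u v : Fin n) → χ u v ≡ rowColor (toℕ u) ⊎ χ u v ≡ columnColor (toℕ v)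

rowColumn⇒star : ∀ {n} {χ : Coloring n} → RowColumnColoring χ → StarColoring χ
rowColumn⇒star {χ = χ} rowColumn u u' v v' χuv≡χu'v' =
  compare (rowColumn u v) (rowColumn u' v')
  where
  same : ∀ {x y} → χ u v ≡ x → χ u' v' ≡ y → x ≡ y
  same χuv≡x χu'v'≡y = trans (sym χuv≡x) (trans χuv≡χu'v' χu'v'≡y)
  compare : χ u v ≡ rowColor (toℕ u) ⊎ χ u v ≡ columnColor (toℕ v) →
            χ u' v' ≡ rowColor (toℕ u') ⊎ χ u' v' ≡ columnColor (toℕ v') →
            u ≡ u' ⊎ v ≡ v'
  compare (inj₁ row) (inj₁ row') = inj₁ (toℕ-injective (*-cancelˡ-≡ _ _ 2 (same row row')))
  compare (inj₂ col) (inj₂ col') =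
    inj₂ (toℕ-injective (*-cancelˡ-≡ _ _ 2 (suc-injective (same col col'))))
  compare (inj₁ row) (inj₂ col') = ⊥-elim (even≢odd (toℕ u) (toℕ v') (same row col'))
  compare (inj₂ col) (inj₁ row') = ⊥-elim (even≢odd (toℕ u') (toℕ v) (sym (same col row')))

module HalfSplit (h : ℕ) where

  isLow : Fin (2 * h) → Bool
  isLow x = ⌊ toℕ x <? h ⌋

  half : Bool → List ℕ
  half true  = upTo h
  half false = map (h +_) (upTo h)

  length-half : ∀ low → length (half low) ≡ h
  length-half true  = length-upTo h
  length-half false = trans (length-map (h +_) (upTo h)) (length-upTo h)

  toℕ∈half : ∀ x → toℕ x List.∈ half (isLow x)
  toℕ∈half x with toℕ x <? h
  ... | yes x<h = ∈-upTo⁺ x<h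
  ... | no  x≮h =
    subst (List._∈ half false) (m+[n∸m]≡n h≤x) (∈-map⁺ (h +_) (∈-upTo⁺ x∸h<h))
    where
    h≤x : h ≤ toℕ x
    h≤x = ≮⇒≥ x≮h
    x∸h<h : toℕ x ∸ h < h
    x∸h<h = subst (toℕ x ∸ h <_) (trans (m+n∸m≡n h (h + 0)) (+-identityʳ h))
                  (∸-monoˡ-< (toℕ<n x) h≤x)

  splitColoring : Coloring (2 * h)
  splitColoring u v =
    if isLow u xor isLow v then rowColor (toℕ u) else columnColor (toℕ v)

  splitColoring-rowColumn : RowColumnColoring splitColoring
  splitColoring-rowColumn u v with isLow u xor isLow v
  ... | true  = inj₁ refl
  ... | false = inj₂ refl

  candidates : ℕ → (ℕ → ℕ) → Bool → List ℕ
  candidates x f low = x ∷ₗ map f (half low)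

  length-candidates : ∀ x f low → length (candidates x f low) ≡ suc h
  length-candidates x f low = cong suc (trans (length-map f (half low)) (length-half low))

  colorAtU : ∀ u v →
             splitColoring u v List.∈ candidates (rowColor (toℕ u)) columnColor (isLow u)
  colorAtU u v with isLow u | isLow v | toℕ∈half v
  ... | true  | true  | v∈ = Any.there (∈-map⁺ columnColor v∈)
  ... | false | false | v∈ = Any.there (∈-map⁺ columnColor v∈)
  ... | true  | false | _  = Any.here refl
  ... | false | true  | _  = Any.here refl

  colorAtV : ∀ v u →
             splitColoring u v List.∈ candidates (columnColor (toℕ v)) rowColor (not (isLow v))
  colorAtV v u with isLow u | isLow v | toℕ∈half u
  ... | true  | true  | _  = Any.here refl
  ... | false | false | _  = Any.here refl
  ... | true  | false | u∈ = Any.there (∈-map⁺ rowColor u∈)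
  ... | false | true  | u∈ = Any.there (∈-map⁺ rowColor u∈)

  splitColoring-local : Local (suc h) splitColoring
  splitColoring-local =
      (λ u → ≤-trans (colorsU-length-≤ splitColoring u (colorAtU u))
                     (≤-reflexive (length-candidates (rowColor (toℕ u)) columnColor (isLow u))))
    , (λ v → ≤-trans (colorsV-length-≤ splitColoring v (colorAtV v))
                     (≤-reflexive (length-candidates (columnColor (toℕ v)) rowColor (not (isLow v)))))

local-mono : ∀ {n} {m m'} {χ : Coloring n} → m ≤ m' → Local m χ → Local m' χ
local-mono m≤m' (localU , localV) = (λ u → ≤-trans (localU u) m≤m')
                                  , (λ v → ≤-trans (localV v) m≤m')

monoK₁₁ : ∀ {n} → Fin n → (χ : Coloring n) → HasMonoKpp 1 χ
monoK₁₁ w χ = ⁅ w ⁆ , ⁅ w ⁆ , χ w w , ∣⁅x⁆∣≡1 w , ∣⁅x⁆∣≡1 w ,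
  λ a b a∈ b∈ → cong₂ χ (x∈⁅y⁆⇒x≡y w a∈) (x∈⁅y⁆⇒x≡y w b∈)

1+2t≤3t : ∀ t → 1 ≤ t → suc (2 * t) ≤ 3 * t
1+2t≤3t t 1≤t = +-monoˡ-≤ (2 * t) 1≤t

4t≤2[1+q][3t∸1] : ∀ t q → 1 ≤ t → 2 * (2 * t) ≤ 2 * suc q * (3 * t ∸ 1)
4t≤2[1+q][3t∸1] t@(suc s) q _ = begin
  2 * (2 * t)               ≤⟨ *-monoʳ-≤ 2 (m≤n+m (2 * t) s) ⟩
  2 * (3 * t ∸ 1)           ≤⟨ *-monoˡ-≤ (3 * t ∸ 1) (m≤m*n 2 (suc q)) ⟩
  2 * suc q * (3 * t ∸ 1)   ∎
  where open ≤-Reasoning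

theorem3 : (k : ℕ) → 2 ≤ k → (p : ℕ) → 1 ≤ p →
    ((χ : Coloring (2 ^ k)) → ShufflePreserved χ → Local (3 * 2 ^ (k ∸ 2)) χ →
    HasMonoKpp p χ)
    ⇔ (2 * (p ∸ 1) * (3 * 2 ^ (k ∸ 2) ∸ 1) < 2 ^ k)
theorem3 (suc zero) (s≤s ()) _ _
theorem3 (suc (suc j)) _ (suc zero) _ = mk⇔ (λ _ → 0<n) λ _ χ _ _ → monoK₁₁ (fromℕ< 0<n) χ
  where
  0<n : 0 < 2 ^ suc (suc j)
  0<n = m^n>0 2 (suc (suc j))
theorem3 (suc (suc j)) _ (suc (suc q)) _ = mk⇔
  (λ always → ⊥-elim (star⇒¬monoKpp star q
    (always splitColoring (star⇒shufflePreserved star)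
            (local-mono (1+2t≤3t (2 ^ j) (m^n>0 2 j)) splitColoring-local))))
  (λ below → ⊥-elim (<⇒≱ below (4t≤2[1+q][3t∸1] (2 ^ j) q (m^n>0 2 j))))
  where
  open HalfSplit (2 * 2 ^ j)
  star : StarColoring splitColoring
  star = rowColumn⇒star splitColoring-rowColumn
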